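{- Let $C\subset\mathbb{H}_n$ be small and $\varphi(\bar x,\bar y)\in\mathcal{L}_R(C)$ such that no conjunct of $\varphi$ is of the form $x_i\,R\,y_j$. If $\bar b$ is a tuple of elements of $\mathbb{H}_n\setminus C$ such that $\varphi(\bar x,\bar b)$ is consistent, then $\varphi(\bar x,\bar b)$ does not divide over $C$.
   Context: Fix $n\ge3$. Language $\{R\}$, $R$ the symmetric irreflexive edge relation. $T_n$ is the complete theory of the generic $K_n$-free (Henson) graph ($K_n$ the complete graph on $n$ vertices): the unique countable $K_n$-free graph into which every finite $K_n$-free graph embeds as an induced subgraph and in which every isomorphism between finite induced subgraphs extends to an automorphism. $\mathbb{H}_n$ is a sufficiently saturated monster model of $T_n$; "$C\subset\mathbb{H}_n$" means $C$ is small. Dividing: $\varphi(\bar x,\bar b)$ divides over $C$ if there is a $C$-indiscernible sequence $(\bar b^l)_{l<\omega}$ with $\bar b^0=\bar b$ such that $\{\varphi(\bar x,\bar b^l):l<\omega\}$ is inconsistent. $\mathcal{L}_0(C)$: conjunctions of atomic and negated atomic formulas with parameters from $C$, no conjunct $x=c$ ($x$ a variable, $c\in C$); for $\varphi(\bar x,\bar y)$ also no conjunct $x_i=x_j$ or $y_i=y_j$ with $i\ne j$; formulas symmetrically closed (so $x_i\,R\,y_j$ is a conjunct iff $y_j\,R\,x_i$ is). $\mathcal{L}_R(C)$: those $\varphi(\bar x,\bar y)\in\mathcal{L}_0(C)$ with no conjunct $x_i=y_j$. -}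

module Defs where

open import Level using (0ℓ)
open import Data.Nat using (ℕ; zero; suc; _∸_; _≤_) renaming (_<_ to _<ℕ_)
open import Data.Fin using (Fin) renaming (_<_ to _<F_)
open import Data.Maybe using (Maybe; just; nothing)
open import Data.Sum using (_⊎_; inj₁; inj₂)
open import Data.Product using (Σ; _×_; _,_; ∃; ∃-syntax)
open import Data.List using (List)
open import Data.List.Membership.Propositional using (_∈_; _∉_)
open import Data.List.Relation.Unary.All using (All)
open import Data.Empty using (⊥)
open import Relation.Nullary using (¬_)
open import Relation.Binary.PropositionalEquality using (_≡_; _≢_)
open import Function.Bundles using (_⇔_)

record Graph : Set₁ where
  field
    Carrier : Set
    _R_     : Carrier → Carrier → Set

module _ (G : Graph) where
  open Graph G

  KFreeList : ℕ → List Carrier → Set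
  KFreeList k U = ¬ (Σ (Fin k → Carrier) λ f →
                       (∀ i → f i ∈ U) ×
                       (∀ i j → i ≢ j → f i R f j))

  KFree : ℕ → Set
  KFree k = ¬ (Σ (Fin k → Carrier) λ f → (∀ i j → i ≢ j → f i R f j))

  -- Models of T_n: the standard axiomatisation of the theory of the generic
  -- K_n-free graph (symmetric irreflexive, K_n-free, and the extension axioms).
  record ModelOfT (n : ℕ) : Set where
    field
      sym     : ∀ {a b} → a R b → b R a
      irrefl  : ∀ {a} → ¬ (a R a)
      Kn-free : KFree n
      extend  : (U V : List Carrier) →
                (∀ {u} → u ∈ U → u ∉ V) →
                KFreeList (n ∸ 1) U →
                ∃[ z ] (z ∉ U × z ∉ V ×
                        (∀ {u} → u ∈ U → z R u) ×
                        (∀ {v} → v ∈ V → ¬ (z R v)))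

data Term (P V : Set) : Set where
  var : V → Term P V
  par : P → Term P V

data Formula (P : Set) : Set → Set₁ where
  rel  : ∀ {V} → Term P V → Term P V → Formula P V
  eq   : ∀ {V} → Term P V → Term P V → Formula P V
  neg  : ∀ {V} → Formula P V → Formula P V
  conj : ∀ {V} → Formula P V → Formula P V → Formula P V
  disj : ∀ {V} → Formula P V → Formula P V → Formula P V
  ex   : ∀ {V} → Formula P (Maybe V) → Formula P V
  all  : ∀ {V} → Formula P (Maybe V) → Formula P V

module _ (G : Graph) where
  open Graph G

  evalT : ∀ {P V} → (P → Carrier) → (V → Carrier) → Term P V → Carrier
  evalT p v (var x) = v x
  evalT p v (par c) = p c

  extendV : ∀ {V : Set} → (V → Carrier) → Carrier → Maybe V → Carrier
  extendV v a nothing  = a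
  extendV v a (just x) = v x

  -- satisfaction (read classically; see the excluded-middle hypothesis)
  Sat : ∀ {P V} → Formula P V → (P → Carrier) → (V → Carrier) → Set
  Sat (rel s t)  p v = evalT p v s R evalT p v t
  Sat (eq s t)   p v = evalT p v s ≡ evalT p v t
  Sat (neg φ)    p v = ¬ Sat φ p v
  Sat (conj φ ψ) p v = Sat φ p v × Sat ψ p v
  Sat (disj φ ψ) p v = Sat φ p v ⊎ Sat ψ p v
  Sat (ex φ)     p v = Σ Carrier λ a → Sat φ p (extendV v a)
  Sat (all φ)    p v = (a : Carrier) → Sat φ p (extendV v a)

  -- Saturation with respect to parameter sets of size ≤ |I| + ℵ₀
  -- (i.e. (|I|+ℵ₀)⁺-saturation): every finitely satisfiable set of formulas
  -- in finitely many variables over such a parameter set is realised.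
  Saturated : (I : Set) → Set₁
  Saturated I =
    (p : I ⊎ ℕ → Carrier) (k : ℕ) (Γ : Formula (I ⊎ ℕ) (Fin k) → Set) →
    ((L : List (Formula (I ⊎ ℕ) (Fin k))) → All Γ L →
        Σ (Fin k → Carrier) λ v → All (λ ψ → Sat ψ p v) L) →
    Σ (Fin k → Carrier) λ v → ∀ ψ → Γ ψ → Sat ψ p v

  Indiscernible : ∀ {I : Set} {m : ℕ} → (I → Carrier) → (ℕ → Fin m → Carrier) → Set₁
  Indiscernible {I} {m} c bs =
    (k : ℕ) (ψ : Formula I (Fin k × Fin m)) (i j : Fin k → ℕ) →
    (∀ a a′ → a <F a′ → i a <ℕ i a′) →
    (∀ a a′ → a <F a′ → j a <ℕ j a′) →
    Sat ψ c (λ { (a , t) → bs (i a) t }) ⇔ Sat ψ c (λ { (a , t) → bs (j a) t })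

data LTerm (I : Set) (k m : ℕ) : Set where
  xv : Fin k → LTerm I k m
  yv : Fin m → LTerm I k m
  cv : I → LTerm I k m

data Atom (I : Set) (k m : ℕ) : Set where
  atR  : LTerm I k m → LTerm I k m → Atom I k m
  atEq : LTerm I k m → LTerm I k m → Atom I k m

data Literal (I : Set) (k m : ℕ) : Set where
  pos : Atom I k m → Literal I k m
  ng  : Atom I k m → Literal I k m

-- a formula φ(x̄,ȳ) is the conjunction of its list of literals
LFormula : Set → ℕ → ℕ → Set
LFormula I k m = List (Literal I k m)

IsVar : ∀ {I k m} → LTerm I k m → Set
IsVar (xv _) = Data.Unit.⊤ where import Data.Unit
IsVar (yv _) = Data.Unit.⊤ where import Data.Unit
IsVar (cv _) = ⊥

IsPar : ∀ {I k m} → LTerm I k m → Set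
IsPar (cv _) = Data.Unit.⊤ where import Data.Unit
IsPar _      = ⊥

record InL0 {I : Set} {k m : ℕ} (φ : LFormula I k m) : Set where
  field
    noVarEqPar  : ∀ s t → pos (atEq s t) ∈ φ → IsVar s → ¬ IsPar t
    noParEqVar  : ∀ s t → pos (atEq s t) ∈ φ → IsPar s → ¬ IsVar t
    noXeqX      : ∀ i j → pos (atEq (xv i) (xv j)) ∈ φ → i ≡ j
    noYeqY      : ∀ i j → pos (atEq (yv i) (yv j)) ∈ φ → i ≡ j
    symPos      : ∀ s t → pos (atR s t) ∈ φ → pos (atR t s) ∈ φ
    symNeg      : ∀ s t → ng (atR s t) ∈ φ → ng (atR t s) ∈ φ

record InLR {I : Set} {k m : ℕ} (φ : LFormula I k m) : Set where
  field
    inL0   : InL0 φ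
    noXeqY : ∀ i j → pos (atEq (xv i) (yv j)) ∉ φ
    noYeqX : ∀ i j → pos (atEq (yv j) (xv i)) ∉ φ

NoXRY : ∀ {I k m} → LFormula I k m → Set
NoXRY φ = ∀ i j → pos (atR (xv i) (yv j)) ∉ φ × pos (atR (yv j) (xv i)) ∉ φ

module _ (G : Graph) where
  open Graph G

  evalL : ∀ {I k m} → (I → Carrier) → (Fin k → Carrier) → (Fin m → Carrier) →
          LTerm I k m → Carrier
  evalL c a b (xv i) = a i
  evalL c a b (yv j) = b j
  evalL c a b (cv i) = c i

  SatAtom : ∀ {I k m} → (I → Carrier) → (Fin k → Carrier) → (Fin m → Carrier) →
            Atom I k m → Set
  SatAtom c a b (atR s t)  = evalL c a b s R evalL c a b t
  SatAtom c a b (atEq s t) = evalL c a b s ≡ evalL c a b t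

  SatLit : ∀ {I k m} → (I → Carrier) → (Fin k → Carrier) → (Fin m → Carrier) →
           Literal I k m → Set
  SatLit c a b (pos α) = SatAtom c a b α
  SatLit c a b (ng α)  = ¬ SatAtom c a b α

  SatL : ∀ {I k m} → (I → Carrier) → LFormula I k m →
         (Fin k → Carrier) → (Fin m → Carrier) → Set
  SatL c φ a b = All (SatLit c a b) φ

  Consistent : ∀ {I k m} → (I → Carrier) → LFormula I k m → (Fin m → Carrier) → Set
  Consistent c φ b = Σ _ λ a → SatL c φ a b

  Divides : ∀ {I k m} → (I → Carrier) → LFormula I k m → (Fin m → Carrier) → Set₁
  Divides {I} {k} {m} c φ b =
    Σ (ℕ → Fin m → Carrier) λ bs →
      (∀ j → bs 0 j ≡ b j) ×
      Indiscernible G c bs ×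
      ¬ (Σ (Fin k → Carrier) λ a → ∀ l → SatL c φ a (bs l))

-- By saturation it suffices to realise φ(x̄, b̄⁰) ∧ … ∧ φ(x̄, b̄ᴺ) for every N. Take a
-- realisation ā₀ of φ(x̄, b̄) and a copy ā of it over the parameters C_φ of φ which avoids
-- the b̄ˡ (l ≤ N) and has no edges to them. The x–x and x–C_φ literals of φ hold of ā as
-- they do of ā₀; the x–y literals are all negative (φ ∈ L_R and has no x R y conjunct) and
-- hold by freeness; the y–y and y–C literals pass from b̄ to b̄ˡ by indiscernibility.
-- The free copy is built vertex by vertex with the extension axioms: the vertices a new
-- vertex must be adjacent to are copies of neighbours of its source, so they span no K_{n-1}.
module Submission where

open import Defs
open import Level using (0ℓ)
open import Axiom.ExcludedMiddle using (ExcludedMiddle)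
open import Data.Nat using (ℕ; zero; suc; _+_; _*_; _≤_; _<_; _⊔_; s≤s)
open import Data.Nat.Properties using (≤-refl; ≤-trans; m≤m⊔n; m≤n⊔m)
open import Data.Nat.DivMod
  using (_/_; _mod_; +-distrib-/-∣ʳ; m<n⇒m/n≡0; m*n/n≡m; [m+kn]%n≡m%n; m<n⇒m%n≡m)
open import Data.Nat.Divisibility using (n∣m*n)
open import Data.Fin using (Fin; zero; suc; toℕ) renaming (_<_ to _<F_)
open import Data.Fin.Properties using (toℕ-injective; toℕ-fromℕ<; toℕ<n)
open import Data.Vec.Functional as Vector using (tail)
open import Data.List using (List; []; _∷_; _++_; map; filter; tabulate; allFin; upTo; concatMap; cartesianProductWith)
open import Data.List.Membership.Propositional using (_∈_; _∉_)
open import Data.List.Membership.Propositional.Properties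
open import Data.List.Relation.Unary.All as All using (All; []; _∷_)
open import Data.List.Relation.Unary.Any using (here)
open import Data.List.Relation.Unary.Any.Properties using (¬Any[])
open import Data.Product using (Σ; ∃-syntax; _×_; _,_; proj₁; proj₂)
open import Data.Sum using (_⊎_; inj₁; inj₂)
open import Data.Unit using (tt)
open import Data.Empty using (⊥-elim)
open import Function using (_∘_; id)
open import Function.Bundles using (_⇔_; mk⇔; Equivalence)
open import Function.Related.TypeIsomorphisms using (¬-cong-⇔)
open import Relation.Nullary using (¬_; yes; no)
open import Relation.Binary.PropositionalEquality
  using (_≡_; _≢_; refl; sym; trans; cong; cong₂; subst)

subst₂-⇔ : ∀ {A B : Set} (P : A → B → Set) {a a′ b b′} → a ≡ a′ → b ≡ b′ → P a b ⇔ P a′ b′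
subst₂-⇔ P refl refl = mk⇔ id id

module _ (G : Graph) where
  open Graph G

  record FreeCopy (D B : List Carrier) {k : ℕ} (a a′ : Fin k → Carrier) : Set where
    field
      reflects-≡   : ∀ i j → a′ i ≡ a′ j → a i ≡ a j
      preserves-R  : ∀ i j → a i R a j → a′ i R a′ j
      reflects-R   : ∀ i j → a′ i R a′ j → a i R a j
      preserves-RD : ∀ i {w} → w ∈ D → a i R w → a′ i R w
      reflects-RD  : ∀ i {w} → w ∈ D → a′ i R w → a i R w
      ∉D           : ∀ i → a′ i ∉ D
      ∉B           : ∀ i → a′ i ∉ B
      ¬RB          : ∀ i {w} → w ∈ B → ¬ (a′ i R w)

module _ (EM : ExcludedMiddle 0ℓ) {p : ℕ} {G : Graph} (M : ModelOfT G (suc p))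
         {D B : List (Graph.Carrier G)} (D∩B≡∅ : ∀ {w} → w ∈ D → w ∉ B) where
  open Graph G
  open ModelOfT M renaming (sym to R-sym)

  module ExtendFreeCopy {k} (a : Fin (suc k) → Carrier) (a′ : Fin k → Carrier)
                        (a′-copy : FreeCopy G D B (tail a) a′) where
    open FreeCopy a′-copy

    x : Carrier
    x = a zero

    neighbours : List (Fin k)
    neighbours = filter (λ i → EM {x R a (suc i)}) (allFin k)

    U : List Carrier
    U = map a′ neighbours ++ filter (λ w → EM {x R w}) D

    old : List Carrier
    old = tabulate a′ ++ D ++ B

    V : List Carrier
    V = filter (λ w → EM {w ∉ U}) old

    data U-witness (u : Carrier) : Set where
      copy  : ∀ i → x R a (suc i) → u ≡ a′ i → U-witness u
      param : u ∈ D → x R u → U-witness u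

    U-view : ∀ {u} → u ∈ U → U-witness u
    U-view u∈U with ∈-++⁻ (map a′ neighbours) u∈U
    ... | inj₁ u∈copies =
      let (i , _ , u≡a′i , xRai) = ∈-map∘filter⁻ a′ (λ i → EM {x R a (suc i)}) {xs = allFin k} u∈copies
      in copy i xRai u≡a′i
    ... | inj₂ u∈D′ = let (u∈D , xRu) = ∈-filter⁻ (λ w → EM {x R w}) {xs = D} u∈D′
                      in param u∈D xRu

    copy∈U : ∀ i → x R a (suc i) → a′ i ∈ U
    copy∈U i xRai =
      ∈-++⁺ˡ (∈-map⁺ a′ (∈-filter⁺ (λ i → EM {x R a (suc i)}) (∈-allFin i) xRai))

    param∈U : ∀ {w} → w ∈ D → x R w → w ∈ U
    param∈U w∈D xRw = ∈-++⁺ʳ _ (∈-filter⁺ (λ w → EM {x R w}) w∈D xRw)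

    source : ∀ {u} → U-witness u → Carrier
    source (copy i _ _) = a (suc i)
    source {u} (param _ _) = u

    x-R-source : ∀ {u} (w : U-witness u) → x R source w
    x-R-source (copy _ xRai _) = xRai
    x-R-source (param _ xRu) = xRu

    source-R : ∀ {u u′} (w : U-witness u) (w′ : U-witness u′) → u R u′ → source w R source w′
    source-R (copy i _ refl) (copy j _ refl) r = reflects-R i j r
    source-R (copy i _ refl) (param w∈D _) r = reflects-RD i w∈D r
    source-R (param w∈D _) (copy j _ refl) r = R-sym (reflects-RD j w∈D (R-sym r))
    source-R (param _ _) (param _ _) r = r

    U-KFree : KFreeList G p U
    U-KFree (f , f∈U , f-clique) = Kn-free (F , F-clique)
      where
        F : Fin (suc p) → Carrier
        F zero = x
        F (suc i) = source (U-view (f∈U i))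

        F-clique : ∀ i j → i ≢ j → F i R F j
        F-clique zero zero i≢j = ⊥-elim (i≢j refl)
        F-clique zero (suc j) _ = x-R-source (U-view (f∈U j))
        F-clique (suc i) zero _ = R-sym (x-R-source (U-view (f∈U i)))
        F-clique (suc i) (suc j) i≢j =
          source-R (U-view (f∈U i)) (U-view (f∈U j)) (f-clique i j (i≢j ∘ cong suc))

    private
      U∩V≡∅ : ∀ {u} → u ∈ U → u ∉ V
      U∩V≡∅ u∈U u∈V = proj₂ (∈-filter⁻ (λ w → EM {w ∉ U}) {xs = old} u∈V) u∈U

      extension : ∃[ z ] (z ∉ U × z ∉ V × (∀ {u} → u ∈ U → z R u) × (∀ {v} → v ∈ V → ¬ (z R v)))
      extension = extend U V U∩V≡∅ U-KFree

    z : Carrier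
    z = proj₁ extension

    z∉U : z ∉ U
    z∉U = proj₁ (proj₂ extension)

    z∉V : z ∉ V
    z∉V = proj₁ (proj₂ (proj₂ extension))

    z-R-U : ∀ {u} → u ∈ U → z R u
    z-R-U = proj₁ (proj₂ (proj₂ (proj₂ extension)))

    z-¬R-V : ∀ {v} → v ∈ V → ¬ (z R v)
    z-¬R-V = proj₂ (proj₂ (proj₂ (proj₂ extension)))

    old⊆U∪V : ∀ {w} → w ∈ old → w ∈ U ⊎ w ∈ V
    old⊆U∪V {w} w∈old with EM {w ∈ U}
    ... | yes w∈U = inj₁ w∈U
    ... | no w∉U = inj₂ (∈-filter⁺ (λ w → EM {w ∉ U}) w∈old w∉U)

    z∉old : z ∉ old
    z∉old z∈old with old⊆U∪V z∈old
    ... | inj₁ z∈U = z∉U z∈U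
    ... | inj₂ z∈V = z∉V z∈V

    z-R-old⇒∈U : ∀ {w} → w ∈ old → z R w → w ∈ U
    z-R-old⇒∈U w∈old r with old⊆U∪V w∈old
    ... | inj₁ w∈U = w∈U
    ... | inj₂ w∈V = ⊥-elim (z-¬R-V w∈V r)

    copy∈old : ∀ i → a′ i ∈ old
    copy∈old i = ∈-++⁺ˡ (∈-tabulate⁺ i)

    D⊆old : ∀ {w} → w ∈ D → w ∈ old
    D⊆old w∈D = ∈-++⁺ʳ (tabulate a′) (∈-++⁺ˡ w∈D)

    B⊆old : ∀ {w} → w ∈ B → w ∈ old
    B⊆old w∈B = ∈-++⁺ʳ (tabulate a′) (∈-++⁺ʳ D w∈B)

    z-R-copy⇒ : ∀ j → z R a′ j → x R a (suc j)
    z-R-copy⇒ j r with U-view (z-R-old⇒∈U (copy∈old j) r)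
    ... | copy i xRai a′j≡a′i = subst (x R_) (sym (reflects-≡ j i a′j≡a′i)) xRai
    ... | param a′j∈D _ = ⊥-elim (∉D j a′j∈D)

    z-R-D⇒ : ∀ {w} → w ∈ D → z R w → x R w
    z-R-D⇒ w∈D r with U-view (z-R-old⇒∈U (D⊆old w∈D) r)
    ... | copy i _ refl = ⊥-elim (∉D i w∈D)
    ... | param _ xRw = xRw

    extended : FreeCopy G D B a (z Vector.∷ a′)
    FreeCopy.reflects-≡ extended zero zero _ = refl
    FreeCopy.reflects-≡ extended zero (suc j) z≡a′j = ⊥-elim (z∉old (subst (_∈ old) (sym z≡a′j) (copy∈old j)))
    FreeCopy.reflects-≡ extended (suc i) zero a′i≡z = ⊥-elim (z∉old (subst (_∈ old) a′i≡z (copy∈old i)))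
    FreeCopy.reflects-≡ extended (suc i) (suc j) = reflects-≡ i j
    FreeCopy.preserves-R extended zero zero r = ⊥-elim (irrefl r)
    FreeCopy.preserves-R extended zero (suc j) r = z-R-U (copy∈U j r)
    FreeCopy.preserves-R extended (suc i) zero r = R-sym (z-R-U (copy∈U i (R-sym r)))
    FreeCopy.preserves-R extended (suc i) (suc j) = preserves-R i j
    FreeCopy.reflects-R extended zero zero r = ⊥-elim (irrefl r)
    FreeCopy.reflects-R extended zero (suc j) r = z-R-copy⇒ j r
    FreeCopy.reflects-R extended (suc i) zero r = R-sym (z-R-copy⇒ i (R-sym r))
    FreeCopy.reflects-R extended (suc i) (suc j) = reflects-R i j
    FreeCopy.preserves-RD extended zero w∈D r = z-R-U (param∈U w∈D r)
    FreeCopy.preserves-RD extended (suc i) = preserves-RD i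
    FreeCopy.reflects-RD extended zero = z-R-D⇒
    FreeCopy.reflects-RD extended (suc i) = reflects-RD i
    FreeCopy.∉D extended zero = z∉old ∘ D⊆old
    FreeCopy.∉D extended (suc i) = ∉D i
    FreeCopy.∉B extended zero = z∉old ∘ B⊆old
    FreeCopy.∉B extended (suc i) = ∉B i
    FreeCopy.¬RB extended zero w∈B r with U-view (z-R-old⇒∈U (B⊆old w∈B) r)
    ... | copy i _ refl = ∉B i w∈B
    ... | param w∈D _ = D∩B≡∅ w∈D w∈B
    FreeCopy.¬RB extended (suc i) = ¬RB i

  freeCopy : ∀ {k} (a : Fin k → Carrier) → Σ (Fin k → Carrier) (FreeCopy G D B a)
  freeCopy {zero} a = (λ ()) , record
    { reflects-≡ = λ () ; preserves-R = λ () ; reflects-R = λ () ; preserves-RD = λ ()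
    ; reflects-RD = λ () ; ∉D = λ () ; ∉B = λ () ; ¬RB = λ () }
  freeCopy {suc k} a =
    let (a′ , a′-copy) = freeCopy (tail a)
        open ExtendFreeCopy a a′ a′-copy
    in (z Vector.∷ a′) , extended

module _ {G : Graph} {I : Set} {m : ℕ} {c : I → Graph.Carrier G} {bs : ℕ → Fin m → Graph.Carrier G}
         (ind : Indiscernible G c bs) where

  indiscernible-single : ∀ ψ l →
    Sat G ψ c (λ { (_ , j) → bs 0 j }) ⇔ Sat G ψ c (λ { (_ , j) → bs l j })
  indiscernible-single ψ l = ind 1 ψ (λ _ → 0) (λ _ → l) no-pair no-pair
    where
      no-pair : ∀ {f : Fin 1 → ℕ} i j → i <F j → f i < f j
      no-pair zero zero ()

module _ (G : Graph) {I : Set} {k m : ℕ} (c : I → Graph.Carrier G) where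
  open Graph G

  SatLit-cong : ∀ {a : Fin k → Carrier} {b b′ : Fin m → Carrier} → (∀ j → b j ≡ b′ j) →
                (lit : Literal I k m) → SatLit G c a b lit ⇔ SatLit G c a b′ lit
  SatLit-cong {a} {b} {b′} b≡b′ = literal
    where
      term : ∀ t → evalL G c a b t ≡ evalL G c a b′ t
      term (xv _) = refl
      term (yv j) = b≡b′ j
      term (cv _) = refl

      atom : ∀ α → SatAtom G c a b α ⇔ SatAtom G c a b′ α
      atom (atR s t) = subst₂-⇔ _R_ (term s) (term t)
      atom (atEq s t) = subst₂-⇔ _≡_ (term s) (term t)

      literal : ∀ lit → SatLit G c a b lit ⇔ SatLit G c a b′ lit
      literal (pos α) = atom α
      literal (ng α) = ¬-cong-⇔ (atom α)

code : ∀ {m} → ℕ → Fin m → ℕ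
code {m} l j = toℕ j + l * m

-- For m = 0 no number is a code, and every number decodes to the junk value d.
decode : ∀ {A : Set} {m} → A → (ℕ → Fin m → A) → ℕ → A
decode {m = zero} d f n = d
decode {m = suc m} d f n = f (n / suc m) (n mod suc m)

decode-code : ∀ {A : Set} {m} (d : A) (f : ℕ → Fin m → A) l j → decode d f (code l j) ≡ f l j
decode-code {m = suc m} d f l j = cong₂ f quotient remainder
  where
    quotient : (toℕ j + l * suc m) / suc m ≡ l
    quotient = trans (+-distrib-/-∣ʳ (toℕ j) (n∣m*n l))
                     (cong₂ _+_ (m<n⇒m/n≡0 (toℕ<n j)) (m*n/n≡m l (suc m)))

    remainder : (toℕ j + l * suc m) mod suc m ≡ j
    remainder = toℕ-injective (trans (toℕ-fromℕ< _)
                                (trans ([m+kn]%n≡m%n (toℕ j) l (suc m)) (m<n⇒m%n≡m (toℕ<n j))))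

-- Saturation only speaks of parameters from I ⊎ ℕ, so the entries of b̄ˡ are coded into ℕ.
module Translation (G : Graph) {I : Set} {k m : ℕ} (c : I → Graph.Carrier G)
                   (bs : ℕ → Fin m → Graph.Carrier G) (d : Graph.Carrier G) where
  open Graph G

  parameter : I ⊎ ℕ → Carrier
  parameter (inj₁ t) = c t
  parameter (inj₂ n) = decode d bs n

  term : ℕ → LTerm I k m → Term (I ⊎ ℕ) (Fin k)
  term l (xv i) = var i
  term l (yv j) = par (inj₂ (code l j))
  term l (cv t) = par (inj₁ t)

  atom : ℕ → Atom I k m → Formula (I ⊎ ℕ) (Fin k)
  atom l (atR s t) = rel (term l s) (term l t)
  atom l (atEq s t) = eq (term l s) (term l t)

  literal : ℕ → Literal I k m → Formula (I ⊎ ℕ) (Fin k)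
  literal l (pos α) = atom l α
  literal l (ng α) = neg (atom l α)

  evalT-term : ∀ l v t → evalT G parameter v (term l t) ≡ evalL G c v (bs l) t
  evalT-term l v (xv i) = refl
  evalT-term l v (yv j) = decode-code d bs l j
  evalT-term l v (cv t) = refl

  Sat-atom : ∀ l {v} α → Sat G (atom l α) parameter v ⇔ SatAtom G c v (bs l) α
  Sat-atom l {v} (atR s t) = subst₂-⇔ _R_ (evalT-term l v s) (evalT-term l v t)
  Sat-atom l {v} (atEq s t) = subst₂-⇔ _≡_ (evalT-term l v s) (evalT-term l v t)

  Sat-literal : ∀ l {v} lit → Sat G (literal l lit) parameter v ⇔ SatLit G c v (bs l) lit
  Sat-literal l (pos α) = Sat-atom l α
  Sat-literal l (ng α) = ¬-cong-⇔ (Sat-atom l α)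

module _ {I : Set} {k m : ℕ} where

  termParams : LTerm I k m → List I
  termParams (cv t) = t ∷ []
  termParams _ = []

  atomParams : Atom I k m → List I
  atomParams (atR s t) = termParams s ++ termParams t
  atomParams (atEq s t) = termParams s ++ termParams t

  literalParams : Literal I k m → List I
  literalParams (pos α) = atomParams α
  literalParams (ng α) = atomParams α

  params : LFormula I k m → List I
  params = concatMap literalParams

module Realisation
  (EM : ExcludedMiddle 0ℓ) {p : ℕ} (G : Graph) (M : ModelOfT G (suc (suc p)))
  {I : Set} (sat : Saturated G I) (c : I → Graph.Carrier G)
  {k m : ℕ} (φ : LFormula I k m) (φ∈LR : InLR φ) (noXRY : NoXRY φ)
  (b : Fin m → Graph.Carrier G) (b∉C : ∀ j i → b j ≢ c i)
  (a₀ : Fin k → Graph.Carrier G) (φa₀b : SatL G c φ a₀ b)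
  (bs : ℕ → Fin m → Graph.Carrier G) (bs₀≡b : ∀ j → bs 0 j ≡ b j) (ind : Indiscernible G c bs)
  where
  open Graph G
  open ModelOfT M renaming (sym to R-sym)
  open InLR φ∈LR
  open InL0 inL0

  D : List Carrier
  D = map c (params φ)

  B : ℕ → List Carrier
  B N = cartesianProductWith bs (upTo (suc N)) (allFin m)

  param∈D : ∀ {lit t} → lit ∈ φ → t ∈ literalParams lit → c t ∈ D
  param∈D lit∈φ t∈lit = ∈-map⁺ c (∈-concat⁺′ t∈lit (∈-map⁺ literalParams lit∈φ))

  bs∈B : ∀ {l N} j → l ≤ N → bs l j ∈ B N
  bs∈B j l≤N = ∈-cartesianProductWith⁺ bs (∈-upTo⁺ (s≤s l≤N)) (∈-allFin j)

  y : Fin m → Term I (Fin 1 × Fin m)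
  y j = var (zero , j)

  along : ∀ ψ l → Sat G ψ c (λ { (_ , j) → bs 0 j }) → Sat G ψ c (λ { (_ , j) → bs l j })
  along ψ l = Equivalence.to (indiscernible-single ind ψ l)

  bs∉C : ∀ l j t → bs l j ≢ c t
  bs∉C l j t bsₗj≡ct = b∉C j t (trans (sym (bs₀≡b j)) bs₀j≡ct)
    where
      bs₀j≡ct : bs 0 j ≡ c t
      bs₀j≡ct = Equivalence.from (indiscernible-single ind (eq (y j) (par t)) l) bsₗj≡ct

  D∩B≡∅ : ∀ {N w} → w ∈ D → w ∉ B N
  D∩B≡∅ {N} w∈D w∈B
    with ∈-map⁻ c w∈D | ∈-cartesianProductWith⁻ bs (upTo (suc N)) (allFin m) w∈B
  ... | t , _ , refl | l , j , _ , _ , ct≡bslj = bs∉C l j t (sym ct≡bslj)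

  φa₀bs₀ : SatL G c φ a₀ (bs 0)
  φa₀bs₀ = All.map (λ {lit} → Equivalence.to (SatLit-cong G c (sym ∘ bs₀≡b) lit)) φa₀b

  module _ {N : ℕ} {a : Fin k → Carrier} (a-copy : FreeCopy G D (B N) a₀ a) {l : ℕ} (l≤N : l ≤ N) where
    open FreeCopy a-copy

    positive-literal : ∀ α → pos α ∈ φ → SatAtom G c a₀ (bs 0) α → SatAtom G c a (bs l) α
    positive-literal (atR (xv i) (xv j)) _ r = preserves-R i j r
    positive-literal (atR (xv i) (yv j)) mem _ = ⊥-elim (proj₁ (noXRY i j) mem)
    positive-literal (atR (xv i) (cv t)) mem r = preserves-RD i (param∈D mem (here refl)) r
    positive-literal (atR (yv j) (xv i)) mem _ = ⊥-elim (proj₂ (noXRY i j) mem)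
    positive-literal (atR (yv j) (yv j′)) _ = along (rel (y j) (y j′)) l
    positive-literal (atR (yv j) (cv t)) _ = along (rel (y j) (par t)) l
    positive-literal (atR (cv t) (xv i)) mem r = R-sym (preserves-RD i (param∈D mem (here refl)) (R-sym r))
    positive-literal (atR (cv t) (yv j)) _ = along (rel (par t) (y j)) l
    positive-literal (atR (cv t) (cv t′)) _ = id
    positive-literal (atEq (xv i) (xv j)) mem _ = cong a (noXeqX i j mem)
    positive-literal (atEq (xv i) (yv j)) mem _ = ⊥-elim (noXeqY i j mem)
    positive-literal (atEq (xv i) (cv t)) mem _ = ⊥-elim (noVarEqPar (xv i) (cv t) mem tt tt)
    positive-literal (atEq (yv j) (xv i)) mem _ = ⊥-elim (noYeqX i j mem)
    positive-literal (atEq (yv j) (yv j′)) _ = along (eq (y j) (y j′)) l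
    positive-literal (atEq (yv j) (cv t)) _ = along (eq (y j) (par t)) l
    positive-literal (atEq (cv t) (xv i)) mem _ = ⊥-elim (noParEqVar (cv t) (xv i) mem tt tt)
    positive-literal (atEq (cv t) (yv j)) _ = along (eq (par t) (y j)) l
    positive-literal (atEq (cv t) (cv t′)) _ = id

    negative-literal : ∀ α → ng α ∈ φ → ¬ SatAtom G c a₀ (bs 0) α → ¬ SatAtom G c a (bs l) α
    negative-literal (atR (xv i) (xv j)) _ ¬r = ¬r ∘ reflects-R i j
    negative-literal (atR (xv i) (yv j)) _ _ = ¬RB i (bs∈B j l≤N)
    negative-literal (atR (xv i) (cv t)) mem ¬r = ¬r ∘ reflects-RD i (param∈D mem (here refl))
    negative-literal (atR (yv j) (xv i)) _ _ = ¬RB i (bs∈B j l≤N) ∘ R-sym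
    negative-literal (atR (yv j) (yv j′)) _ = along (neg (rel (y j) (y j′))) l
    negative-literal (atR (yv j) (cv t)) _ = along (neg (rel (y j) (par t))) l
    negative-literal (atR (cv t) (xv i)) mem ¬r = ¬r ∘ R-sym ∘ reflects-RD i (param∈D mem (here refl)) ∘ R-sym
    negative-literal (atR (cv t) (yv j)) _ = along (neg (rel (par t) (y j))) l
    negative-literal (atR (cv t) (cv t′)) _ = id
    negative-literal (atEq (xv i) (xv j)) _ ¬e = ¬e ∘ reflects-≡ i j
    negative-literal (atEq (xv i) (yv j)) _ _ e = ∉B i (subst (_∈ B N) (sym e) (bs∈B j l≤N))
    negative-literal (atEq (xv i) (cv t)) mem _ e = ∉D i (subst (_∈ D) (sym e) (param∈D mem (here refl)))
    negative-literal (atEq (yv j) (xv i)) _ _ e = ∉B i (subst (_∈ B N) e (bs∈B j l≤N))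
    negative-literal (atEq (yv j) (yv j′)) _ = along (neg (eq (y j) (y j′))) l
    negative-literal (atEq (yv j) (cv t)) _ = along (neg (eq (y j) (par t))) l
    negative-literal (atEq (cv t) (xv i)) mem _ e = ∉D i (subst (_∈ D) e (param∈D mem (here refl)))
    negative-literal (atEq (cv t) (yv j)) _ = along (neg (eq (par t) (y j))) l
    negative-literal (atEq (cv t) (cv t′)) _ = id

    free-copy-satisfies : SatL G c φ a (bs l)
    free-copy-satisfies = All.tabulate literal
      where
        literal : ∀ {lit} → lit ∈ φ → SatLit G c a (bs l) lit
        literal {pos α} mem = positive-literal α mem (All.lookup φa₀bs₀ mem)
        literal {ng α} mem = negative-literal α mem (All.lookup φa₀bs₀ mem)

  copy : ℕ → Fin k → Carrier
  copy N = proj₁ (freeCopy EM M (D∩B≡∅ {N}) a₀)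

  copy-satisfies : ∀ {N l} → l ≤ N → SatL G c φ (copy N) (bs l)
  copy-satisfies {N} = free-copy-satisfies (proj₂ (freeCopy EM M (D∩B≡∅ {N}) a₀))

  vertex : Carrier
  vertex = proj₁ (extend [] [] (λ ()) (λ (_ , f∈[] , _) → ¬Any[] (f∈[] zero)))

  open Translation G {k = k} c bs vertex

  data Γ : Formula (I ⊎ ℕ) (Fin k) → Set where
    instance-at : ∀ l {lit} → lit ∈ φ → Γ (literal l lit)

  maxIndex : ∀ {L} → All Γ L → ℕ
  maxIndex [] = 0
  maxIndex (instance-at l _ ∷ γ) = l ⊔ maxIndex γ

  copy-satisfies-Γ : ∀ N {L} (γ : All Γ L) → maxIndex γ ≤ N →
                     All (λ ψ → Sat G ψ parameter (copy N)) L
  copy-satisfies-Γ N [] _ = []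
  copy-satisfies-Γ N (instance-at l {lit} lit∈φ ∷ γ) ≤N =
    Equivalence.from (Sat-literal l lit) (All.lookup (copy-satisfies (≤-trans (m≤m⊔n l _) ≤N)) lit∈φ)
    ∷ copy-satisfies-Γ N γ (≤-trans (m≤n⊔m l _) ≤N)

  realisation : Σ (Fin k → Carrier) λ a → ∀ l → SatL G c φ a (bs l)
  realisation =
    let (a , a⊨Γ) = sat parameter k Γ (λ _ γ → copy (maxIndex γ) , copy-satisfies-Γ _ γ ≤-refl)
    in a , λ l → All.tabulate λ {lit} lit∈φ →
                   Equivalence.to (Sat-literal l lit) (a⊨Γ _ (instance-at l lit∈φ))

-- Only n ≥ 2 is used: it makes the model nonempty, supplying the junk value for decode.
corollary4p9 : ExcludedMiddle 0ℓ →
    (n : ℕ) → 3 ≤ n →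
    (G : Graph) → ModelOfT G n → (I : Set) → Saturated G I →
    (c : I → Graph.Carrier G) →
    {k m : ℕ} (φ : LFormula I k m) → InLR φ → NoXRY φ →
    (b : Fin m → Graph.Carrier G) → (∀ j i → b j ≢ c i) →
    Consistent G c φ b →
    ¬ Divides G c φ b
corollary4p9 EM (suc (suc p)) (s≤s (s≤s _)) G M I sat c φ φ∈LR noXRY b b∉C
             (a₀ , φa₀b) (bs , bs₀≡b , ind , inconsistent) =
  inconsistent (Realisation.realisation EM G M sat c φ φ∈LR noXRY b b∉C a₀ φa₀b bs bs₀≡b ind)
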